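{- Let $n\geq 3$ and $0<k\leq n/2$ be integers. The accordion graph $A[n,k]$ is bipartite if and only if $n$ and $k$ are both even.
   Context: The accordion graph $A[n,k]$ has vertex set $\{u_1,\dots,u_n,v_1,\dots,v_n\}$ and edge set $\{u_iu_{i+1}, v_iv_{i+1}, u_iv_i, u_iv_{i+k} : i\in\{1,\dots,n\}\}$, indices taken modulo $n$ with residues in $\{1,\dots,n\}$. -}

module Defs where

open import Data.Nat using (ℕ; suc; _+_; _%_; _<_; NonZero)
open import Data.Nat.DivMod using (m%n<n)
open import Data.Fin using (Fin; toℕ; fromℕ<)
open import Data.Bool using (Bool; true; false)
open import Data.Product using (_×_; _,_; Σ)
open import Data.Sum using (_⊎_)
open import Relation.Binary.PropositionalEquality using (_≡_; _≢_)

-- Indices are taken in Fin n = {0,…,n-1} (a relabeling i ↦ i mod n of the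
-- paper's residues {1,…,n}); addition is modulo n.
-- (Fin 0 is empty, so the n = 0 clause is vacuous.)
addMod : ∀ {n} → Fin n → ℕ → Fin n
addMod {suc m} i j = fromℕ< (m%n<n (toℕ i + j) (suc m))

Vertex : ℕ → Set
Vertex n = Bool × Fin n

u v : ∀ {n} → Fin n → Vertex n
u i = false , i
v i = true , i

data IsEdge (n k : ℕ) : Vertex n → Vertex n → Set where
  uu : ∀ i → IsEdge n k (u i) (u (addMod i 1))
  vv : ∀ i → IsEdge n k (v i) (v (addMod i 1))
  uv : ∀ i → IsEdge n k (u i) (v i)
  uvk : ∀ i → IsEdge n k (u i) (v (addMod i k))

Adj : (n k : ℕ) → Vertex n → Vertex n → Set
Adj n k x y = IsEdge n k x y ⊎ IsEdge n k y x

IsBipartite : (n k : ℕ) → Set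
IsBipartite n k = Σ (Vertex n → Bool) λ c → ∀ x y → Adj n k x y → c x ≢ c y

-- A proper 2-colouring must alternate along each of the two n-cycles
-- u_1 … u_n and v_1 … v_n, so n is even; and v_i, v_{i+k} are both
-- adjacent to u_i, hence equally coloured, which forces k even.  Conversely,
-- if n and k are even, colouring x_i by the parity of i (flipped on the
-- v-layer) is proper, since every edge either changes the index by 1 inside a
-- layer or crosses layers with index shift 0 or k.
module Submission where

open import Defs
open import Data.Nat using (ℕ; _≤_; _*_)
open import Data.Nat.Divisibility using (_∣_)
open import Data.Product using (_×_)
open import Function.Bundles using (_⇔_)

open import Data.Bool using (Bool; true; false; not)
open import Data.Bool.Properties using (¬-not; not-¬; not-involutive)
open import Data.Fin using (Fin; zero; toℕ)
open import Data.Fin.Properties using (toℕ-fromℕ<; toℕ-injective; toℕ<n)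
open import Data.Nat using (suc; _+_; _%_; _/_; NonZero; parity)
open import Data.Nat.DivMod
  using (m%n<n; m≡m%n+[m/n]*n; %-distribˡ-+; m%n%n≡m%n; [m+n]%n≡m%n; m<n⇒m%n≡m)
open import Data.Nat.Divisibility using (divides)
open import Data.Nat.Properties using (+-identityʳ; +-assoc)
open import Data.Parity.Base as ℙ using (Parity; 0ℙ; 1ℙ; _⁻¹)
import Data.Parity.Properties as ℙ
open import Data.Product using (_,_; map)
open import Data.Sum using (inj₁; inj₂)
open import Function.Base using (_∘_)
open import Function.Bundles using (mk⇔)
open import Relation.Binary.PropositionalEquality
open import Relation.Nullary using (contradiction)

flipBy : Parity → Bool → Bool
flipBy 0ℙ b = b
flipBy 1ℙ b = not b

flipBy-⁻¹ : ∀ p b → flipBy (p ⁻¹) b ≡ not (flipBy p b)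
flipBy-⁻¹ 0ℙ b = refl
flipBy-⁻¹ 1ℙ b = sym (not-involutive b)

flipBy-+ : ∀ p q b → flipBy (p ℙ.+ q) b ≡ flipBy p (flipBy q b)
flipBy-+ 0ℙ q b = refl
flipBy-+ 1ℙ q b = flipBy-⁻¹ q b

flipBy-not : ∀ p b → flipBy p (not b) ≡ not (flipBy p b)
flipBy-not 0ℙ b = refl
flipBy-not 1ℙ b = refl

flipBy-fixed⇒0ℙ : ∀ p b → flipBy p b ≡ b → p ≡ 0ℙ
flipBy-fixed⇒0ℙ 0ℙ b _  = refl
flipBy-fixed⇒0ℙ 1ℙ b eq = contradiction (sym eq) (not-¬ refl)

2∣⇒parity≡0ℙ : ∀ {n} → 2 ∣ n → parity n ≡ 0ℙ
2∣⇒parity≡0ℙ (divides q refl) = trans (ℙ.*-homo-* q 2) (ℙ.*-zeroʳ (parity q))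

parity≡0ℙ⇒2∣ : ∀ n → parity n ≡ 0ℙ → 2 ∣ n
parity≡0ℙ⇒2∣ 0             _  = divides 0 refl
parity≡0ℙ⇒2∣ 1             ()
parity≡0ℙ⇒2∣ (suc (suc n)) eq with parity≡0ℙ⇒2∣ n eq
... | divides q refl = divides (suc q) refl

parity-%-even : ∀ x {n} .{{_ : NonZero n}} → parity n ≡ 0ℙ → parity (x % n) ≡ parity x
parity-%-even x {n} even = sym (begin
  parity x                                         ≡⟨ cong parity (m≡m%n+[m/n]*n x n) ⟩
  parity (x % n + x / n * n)                       ≡⟨ ℙ.+-homo-+ (x % n) (x / n * n) ⟩
  parity (x % n) ℙ.+ parity (x / n * n)            ≡⟨ cong (parity (x % n) ℙ.+_) (ℙ.*-homo-* (x / n) n) ⟩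
  parity (x % n) ℙ.+ (parity (x / n) ℙ.* parity n) ≡⟨ cong (λ p → parity (x % n) ℙ.+ (parity (x / n) ℙ.* p)) even ⟩
  parity (x % n) ℙ.+ (parity (x / n) ℙ.* 0ℙ)       ≡⟨ cong (parity (x % n) ℙ.+_) (ℙ.*-zeroʳ (parity (x / n))) ⟩
  parity (x % n) ℙ.+ 0ℙ                            ≡⟨ ℙ.+-identityʳ (parity (x % n)) ⟩
  parity (x % n)                                   ∎)
  where open ≡-Reasoning

module _ {m : ℕ} where

  private
    n : ℕ
    n = suc m

  toℕ-addMod : ∀ (i : Fin n) j → toℕ (addMod i j) ≡ (toℕ i + j) % n
  toℕ-addMod i j = toℕ-fromℕ< (m%n<n (toℕ i + j) n)

  addMod-identityʳ : ∀ (i : Fin n) → addMod i 0 ≡ i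
  addMod-identityʳ i = toℕ-injective (begin
    toℕ (addMod i 0) ≡⟨ toℕ-addMod i 0 ⟩
    (toℕ i + 0) % n  ≡⟨ cong (_% n) (+-identityʳ (toℕ i)) ⟩
    toℕ i % n        ≡⟨ m<n⇒m%n≡m (toℕ<n i) ⟩
    toℕ i            ∎)
    where open ≡-Reasoning

  addMod-period : ∀ (i : Fin n) → addMod i n ≡ i
  addMod-period i = toℕ-injective (begin
    toℕ (addMod i n) ≡⟨ toℕ-addMod i n ⟩
    (toℕ i + n) % n  ≡⟨ [m+n]%n≡m%n (toℕ i) n ⟩
    toℕ i % n        ≡⟨ m<n⇒m%n≡m (toℕ<n i) ⟩
    toℕ i            ∎)
    where open ≡-Reasoning

  addMod-assoc : ∀ (i : Fin n) a b → addMod (addMod i a) b ≡ addMod i (a + b)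
  addMod-assoc i a b = toℕ-injective (begin
    toℕ (addMod (addMod i a) b)        ≡⟨ toℕ-addMod (addMod i a) b ⟩
    (toℕ (addMod i a) + b) % n         ≡⟨ cong (λ x → (x + b) % n) (toℕ-addMod i a) ⟩
    ((toℕ i + a) % n + b) % n          ≡⟨ %-distribˡ-+ ((toℕ i + a) % n) b n ⟩
    ((toℕ i + a) % n % n + b % n) % n  ≡⟨ cong (λ x → (x + b % n) % n) (m%n%n≡m%n (toℕ i + a) n) ⟩
    ((toℕ i + a) % n + b % n) % n      ≡⟨ %-distribˡ-+ (toℕ i + a) b n ⟨
    (toℕ i + a + b) % n                ≡⟨ cong (_% n) (+-assoc (toℕ i) a b) ⟩
    (toℕ i + (a + b)) % n              ≡⟨ toℕ-addMod i (a + b) ⟨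
    toℕ (addMod i (a + b))             ∎)
    where open ≡-Reasoning

  parity-addMod : parity n ≡ 0ℙ → ∀ (i : Fin n) j →
                  parity (toℕ (addMod i j)) ≡ parity (toℕ i) ℙ.+ parity j
  parity-addMod even i j = begin
    parity (toℕ (addMod i j))   ≡⟨ cong parity (toℕ-addMod i j) ⟩
    parity ((toℕ i + j) % n)    ≡⟨ parity-%-even (toℕ i + j) even ⟩
    parity (toℕ i + j)          ≡⟨ ℙ.+-homo-+ (toℕ i) j ⟩
    parity (toℕ i) ℙ.+ parity j ∎
    where open ≡-Reasoning

  alternating-addMod : (f : Fin n → Bool) → (∀ i → f (addMod i 1) ≡ not (f i)) →
                       ∀ i j → f (addMod i j) ≡ flipBy (parity j) (f i)
  alternating-addMod f alt i 0       = cong f (addMod-identityʳ i)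
  alternating-addMod f alt i (suc j) = begin
    f (addMod i (suc j))                   ≡⟨ cong f (addMod-assoc i 1 j) ⟨
    f (addMod (addMod i 1) j)              ≡⟨ alternating-addMod f alt (addMod i 1) j ⟩
    flipBy (parity j) (f (addMod i 1))     ≡⟨ cong (flipBy (parity j)) (alt i) ⟩
    flipBy (parity j) (not (f i))          ≡⟨ flipBy-not (parity j) (f i) ⟩
    not (flipBy (parity j) (f i))          ≡⟨ flipBy-⁻¹ (parity j) (f i) ⟨
    flipBy (parity j ⁻¹) (f i)             ≡⟨ cong (λ p → flipBy p (f i)) (ℙ.+-homo-+ 1 j) ⟨
    flipBy (parity (suc j)) (f i)          ∎
    where open ≡-Reasoning

  alternating⇒parity≡0ℙ : (f : Fin n → Bool) → (∀ i → f (addMod i 1) ≡ not (f i)) →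
                          parity n ≡ 0ℙ
  alternating⇒parity≡0ℙ f alt = flipBy-fixed⇒0ℙ (parity n) (f zero)
    (trans (sym (alternating-addMod f alt zero n)) (cong f (addMod-period zero)))

adjacent-along-layer : ∀ {n k} b (i : Fin n) → Adj n k (b , i) (b , addMod i 1)
adjacent-along-layer false i = inj₁ (uu i)
adjacent-along-layer true  i = inj₁ (vv i)

module _ {m k : ℕ} where

  private
    n : ℕ
    n = suc m

  bipartite⇒even : IsBipartite n k → parity n ≡ 0ℙ × parity k ≡ 0ℙ
  bipartite⇒even (c , proper) = alternating⇒parity≡0ℙ (c ∘ u) (alternates false) , k-even
    where
    flips : ∀ x y → Adj n k x y → c y ≡ not (c x)
    flips x y adj = ¬-not (≢-sym (proper x y adj))

    alternates : ∀ b i → c (b , addMod i 1) ≡ not (c (b , i))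
    alternates b i = flips _ _ (adjacent-along-layer b i)

    k-even : parity k ≡ 0ℙ
    k-even = flipBy-fixed⇒0ℙ (parity k) (c (v zero)) (begin
      flipBy (parity k) (c (v zero)) ≡⟨ alternating-addMod (c ∘ v) (alternates true) zero k ⟨
      c (v (addMod zero k))          ≡⟨ flips _ _ (inj₁ (uvk zero)) ⟩
      not (c (u zero))               ≡⟨ flips _ _ (inj₁ (uv zero)) ⟨
      c (v zero)                     ∎)
      where open ≡-Reasoning

  parityColouring : Vertex n → Bool
  parityColouring (b , i) = flipBy (parity (toℕ i)) b

  module _ (n-even : parity n ≡ 0ℙ) (k-even : parity k ≡ 0ℙ) where

    parityColouring-shift : ∀ b i j →
      parityColouring (b , addMod i j) ≡ flipBy (parity j) (parityColouring (b , i))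
    parityColouring-shift b i j = begin
      flipBy (parity (toℕ (addMod i j))) b      ≡⟨ cong (λ p → flipBy p b) (parity-addMod n-even i j) ⟩
      flipBy (parity (toℕ i) ℙ.+ parity j) b    ≡⟨ cong (λ p → flipBy p b) (ℙ.+-comm (parity (toℕ i)) (parity j)) ⟩
      flipBy (parity j ℙ.+ parity (toℕ i)) b    ≡⟨ flipBy-+ (parity j) (parity (toℕ i)) b ⟩
      flipBy (parity j) (flipBy (parity (toℕ i)) b) ∎
      where open ≡-Reasoning

    parityColouring-flips : ∀ x y → IsEdge n k x y → parityColouring y ≡ not (parityColouring x)
    parityColouring-flips _ _ (uu i)  = parityColouring-shift false i 1
    parityColouring-flips _ _ (vv i)  = parityColouring-shift true i 1
    parityColouring-flips _ _ (uv i)  = flipBy-not (parity (toℕ i)) false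
    parityColouring-flips _ _ (uvk i) = begin
      parityColouring (v (addMod i k))               ≡⟨ parityColouring-shift true i k ⟩
      flipBy (parity k) (parityColouring (v i))      ≡⟨ cong (λ p → flipBy p (parityColouring (v i))) k-even ⟩
      parityColouring (v i)                          ≡⟨ parityColouring-flips _ _ (uv i) ⟩
      not (parityColouring (u i))                    ∎
      where open ≡-Reasoning

    even⇒bipartite : IsBipartite n k
    even⇒bipartite = parityColouring , proper
      where
      proper : ∀ x y → Adj n k x y → parityColouring x ≢ parityColouring y
      proper x y (inj₁ e) eq = not-¬ refl (trans eq (parityColouring-flips x y e))
      proper x y (inj₂ e) eq = not-¬ refl (trans (sym eq) (parityColouring-flips y x e))

  bipartite⇔even : IsBipartite n k ⇔ (2 ∣ n × 2 ∣ k)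
  bipartite⇔even = mk⇔
    (map (parity≡0ℙ⇒2∣ n) (parity≡0ℙ⇒2∣ k) ∘ bipartite⇒even)
    (λ (2∣n , 2∣k) → even⇒bipartite (2∣⇒parity≡0ℙ 2∣n) (2∣⇒parity≡0ℙ 2∣k))

lemma5p2 : (n k : ℕ) → 3 ≤ n → 1 ≤ k → 2 * k ≤ n →
    IsBipartite n k ⇔ (2 ∣ n × 2 ∣ k)
lemma5p2 0       k ()  _ _
lemma5p2 (suc m) k _   _ _ = bipartite⇔even
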